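{- Let $A,B$ be integers, let $\Delta=A^2-4B$, and let $p$ be an odd prime not dividing $B\Delta$. Then $$u_p(A,B)\equiv\frac A2B^{((\frac{\Delta}{p})-1)/2}u_{p-(\frac{\Delta}{p})}(A,B)+\left(\frac{\Delta}{p}\right)\frac{B^{p-1}+1}{2}\pmod{p^2}.$$
   Context: The Lucas sequence $u_n=u_n(A,B)$ is defined by $u_0=0$, $u_1=1$, $u_{n+1}=Au_n-Bu_{n-1}$ for $n\ge1$. $\left(\frac{\cdot}{p}\right)$ is the Legendre symbol. Congruences between rational numbers whose denominators are prime to $p$ are understood in the ring of rationals with denominator prime to $p$ (so $B^{ -1}$ may appear). -}

module Defs where

open import Data.Nat as ℕ using (ℕ; zero; suc)
open import Data.Integer as ℤ using (ℤ; +_; -[1+_])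
open import Data.Rational as ℚ using (ℚ)
open import Data.Nat.Coprimality using (Coprime)
open import Data.List using (List; upTo)
open import Data.Bool.ListAction using (any)
open import Data.Bool using (Bool; true; false; if_then_else_)
open import Relation.Nullary using (Dec; yes; no)
open import Relation.Nullary.Decidable using (⌊_⌋)
open import Data.Product using (∃; _×_)
open import Relation.Binary.PropositionalEquality using (_≡_)

lucasU : ℤ → ℤ → ℕ → ℤ
lucasU A B zero = + 0
lucasU A B (suc zero) = + 1
lucasU A B (suc (suc n)) = A ℤ.* lucasU A B (suc n) ℤ.- B ℤ.* lucasU A B n

-- Legendre symbol (a / p): 0 if p ∣ a, 1 if a is a nonzero square mod p,
-- -1 otherwise.  (Value for p = 0 is irrelevant; set to 0.)
legendre : ℤ → ℕ → ℤ
legendre a zero = + 0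
legendre a (suc k) =
  if ⌊ (a ℤ.%ℕ suc k) ℕ.≟ 0 ⌋ then + 0
  else if any (λ x → ⌊ ((+ x ℤ.* + x ℤ.- a) ℤ.%ℕ suc k) ℕ.≟ 0 ⌋) (upTo (suc k))
       then + 1 else ℤ.- (+ 1)

-- total inverse on ℚ (with 0⁻¹ := 0; only used at nonzero arguments)
invℚ : ℚ → ℚ
invℚ q with q ℚ.≟ ℚ.0ℚ
... | yes _ = ℚ.0ℚ
... | no q≢0 = ℚ.1/_ q {{ℚ.≢-nonZero q≢0}}

_^ℚ_ : ℚ → ℕ → ℚ
q ^ℚ zero = ℚ.1ℚ
q ^ℚ suc n = q ℚ.* (q ^ℚ n)

_^ℚℤ_ : ℚ → ℤ → ℚ
q ^ℚℤ (+ n) = q ^ℚ n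
q ^ℚℤ -[1+ n ] = invℚ (q ^ℚ suc n)

ιℚ : ℤ → ℚ
ιℚ a = a ℚ./ 1

-- Congruence x ≡ y (mod m) in the ring of rationals whose denominator is
-- prime to p: x - y = m · r with r rational of denominator prime to p.
CongModIn : ℕ → ℚ → ℚ → ℤ → Set
CongModIn p x y m = ∃ λ (r : ℚ) → Coprime (ℚ.denominatorℕ r) p × (x ℚ.- y ≡ ιℚ m ℚ.* r)

-- In ℤ[√Δ], (A + √Δ)^(n+1) = 2ⁿ (v_{n+1} + u_{n+1} √Δ) with v_{n+1} = A u_{n+1} − 2B u_n.  Modulo p
-- the freshman's dream gives (A + √Δ)^p ≡ A^p + Δ^((p−1)/2) √Δ, so Fermat's little theorem and
-- Euler's criterion (via Lagrange's bound on the roots of X^((p−1)/2) − 1) yield u_p ≡ ε = (Δ/p)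
-- and v_p ≡ A.  For ε = 1 this means p ∣ u_{p−1} and p ∣ B u_{p−2} + 1; for ε = −1 it means
-- p ∣ u_p + 1 and p ∣ A + B u_{p−1}.  By Cassini's identity u_{n+1}² − A u_{n+1} u_n + B u_n² = Bⁿ,
-- twice (resp. 2B times) the difference of the two sides of the congruence is, up to sign, the
-- norm form a² + A ab + B b² at exactly these two multiples of p, hence divisible by p².
module Submission where

open import Defs
open import Data.Nat as ℕ using (ℕ)
open import Data.Nat.Primality using (Prime)
open import Data.Integer as ℤ using (ℤ; +_)
open import Data.Integer.Divisibility using (_∣_)
open import Data.Rational as ℚ using (ℚ)
open import Relation.Nullary using (¬_)
open import Relation.Binary.PropositionalEquality using (_≡_)

open import Level using (0ℓ)
open import Function using (_∘_)
open import Data.Nat using (zero; suc; _<_; _≤_; z≤n; s≤s; _!)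
import Data.Nat.Properties as ℕP
open import Data.Nat.Properties using (_!*_!≢0)
open import Data.Nat.DivMod using (m/n*n≡m; m<n⇒m%n≡m; m≡m%n+[m/n]*n)
open import Data.Nat.Divisibility as ℕ∣ using (n∣m⇒m%n≡0) renaming (_∣_ to _∣ℕ_)
open import Data.Nat.Combinatorics using (_C_; nCn≡1; nCk≡n!/k![n-k]!; k![n∸k]!∣n!)
open import Data.Nat.Coprimality using (Coprime)
open import Data.Nat.Primality using (euclidsLemma; prime⇒irreducible; ¬prime[0]; ¬prime[1])
import Data.Integer.Properties as ℤP
open import Data.Integer.DivMod using (a≡a%ℕn+[a/ℕn]*n; n%ℕd<d)
open import Data.Integer.Divisibility.Signed as ℤ∣ using (divides) renaming (_∣_ to _∣ˢ_)
import Data.Integer.GCD as ℤGCD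
open import Data.Integer.Tactic.RingSolver using (solve-∀)
import Data.Rational.Properties as ℚP
open import Data.Rational.Unnormalised as ℚᵘ using (mkℚᵘ; *≡*) renaming (_≃_ to _≃ᵘ_)
import Data.Rational.Unnormalised.Properties as ℚᵘP
import Tactic.RingSolver as ℚSolver
import Tactic.RingSolver.Core.AlmostCommutativeRing as ACR
open import Data.Fin using (zero; suc; toℕ; fromℕ; inject₁)
import Data.Fin.Properties as FinP
open import Data.Vec.Functional using (tail; init)
open import Data.Bool using (Bool; true; false; T)
open import Data.Bool.ListAction using (any)
open import Data.Unit using (tt)
open import Data.List using ([]; _∷_; length; upTo; applyUpTo)
open import Data.List.Properties using (length-applyUpTo)
open import Data.List.Relation.Unary.All as All using (All; []; _∷_)
import Data.List.Relation.Unary.All.Properties as All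
open import Data.List.Relation.Unary.AllPairs using (AllPairs; []; _∷_)
import Data.List.Relation.Unary.AllPairs.Properties as AllPairs
open import Data.List.Relation.Unary.Any using (satisfied)
open import Data.List.Relation.Unary.Any.Properties using (any⁺; any⁻)
open import Data.List.Membership.Propositional using (lose)
open import Data.List.Membership.Propositional.Properties using (∈-upTo⁺)
open import Data.Sum using (_⊎_; inj₁; inj₂; [_,_]′)
open import Data.Empty using (⊥-elim)
open import Relation.Nullary using (yes; no)
open import Relation.Nullary.Decidable using (⌊_⌋; toWitness; fromWitness; dec⇒maybe)
open import Relation.Binary.Core using (Rel; _⇒_; _Preserves₂_⟶_⟶_)
open import Relation.Binary.Structures using (IsEquivalence)
open import Relation.Binary.PropositionalEquality using (refl; sym; trans; cong; cong₂; subst; subst₂; module ≡-Reasoning)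
import Relation.Binary.PropositionalEquality as ≡
open import Data.Product.Relation.Binary.Pointwise.NonDependent using (Pointwise; ×-isEquivalence)
open import Algebra.Bundles using (CommutativeSemiring)
open import Algebra.Structures.Biased using (IsCommutativeSemiringˡ; isCommutativeMonoidˡ)

prime∤! : ∀ {p m} → Prime p → m < p → ¬ p ∣ℕ m !
prime∤! {m = zero}  p-prime _   p∣1  = ¬prime[1] (subst Prime (ℕ∣.∣1⇒≡1 p∣1) p-prime)
prime∤! {m = suc m} p-prime m<p p∣m! with euclidsLemma (suc m) (m !) p-prime p∣m!
... | inj₁ p∣1+m = ℕ∣.>⇒∤ m<p p∣1+m
... | inj₂ p∣m!  = prime∤! p-prime (ℕP.<-trans (ℕP.n<1+n m) m<p) p∣m!

prime∣C : ∀ {p k} → Prime p → 0 < k → k < p → p ∣ℕ p C k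
prime∣C {suc n} {k} p-prime 0<k k<p with euclidsLemma (suc n C k) (k ! ℕ.* (suc n ℕ.∸ k) !) p-prime p∣p!
  where
  p∣p! : suc n ∣ℕ (suc n C k) ℕ.* (k ! ℕ.* (suc n ℕ.∸ k) !)
  p∣p! = subst (suc n ∣ℕ_)
    (sym (trans (cong (ℕ._* (k ! ℕ.* (suc n ℕ.∸ k) !)) (nCk≡n!/k![n-k]! (ℕP.<⇒≤ k<p)))
                (m/n*n≡m {{k !* (suc n ℕ.∸ k) !≢0}} (k![n∸k]!∣n! (ℕP.<⇒≤ k<p)))))
    (ℕ∣.m∣m*n (n !))
... | inj₁ p∣C = p∣C
... | inj₂ p∣k![p-k]! with euclidsLemma (k !) ((suc n ℕ.∸ k) !) p-prime p∣k![p-k]!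
...   | inj₁ p∣k!      = ⊥-elim (prime∤! p-prime k<p p∣k!)
...   | inj₂ p∣[p-k]!  = ⊥-elim (prime∤! p-prime (ℕP.∸-monoʳ-< 0<k (ℕP.<⇒≤ k<p)) p∣[p-k]!)

module _ {c ℓ} (R : CommutativeSemiring c ℓ) where
  open CommutativeSemiring R

  quotientCommutativeSemiring : ∀ {ℓ′} {_∼_ : Rel Carrier ℓ′} → IsEquivalence _∼_ → _≈_ ⇒ _∼_ →
    _+_ Preserves₂ _∼_ ⟶ _∼_ ⟶ _∼_ → _*_ Preserves₂ _∼_ ⟶ _∼_ ⟶ _∼_ →
    CommutativeSemiring c ℓ′
  quotientCommutativeSemiring isEquivalence′ ≈⇒∼ +-cong′ *-cong′ = record
    { isCommutativeSemiring = IsCommutativeSemiringˡ.isCommutativeSemiring record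
      { +-isCommutativeMonoid = isCommutativeMonoidˡ record
        { isSemigroup = record
          { isMagma = record { isEquivalence = isEquivalence′ ; ∙-cong = +-cong′ }
          ; assoc   = λ x y z → ≈⇒∼ (+-assoc x y z) }
        ; identityˡ = ≈⇒∼ ∘ +-identityˡ
        ; comm      = λ x y → ≈⇒∼ (+-comm x y) }
      ; *-isCommutativeMonoid = isCommutativeMonoidˡ record
        { isSemigroup = record
          { isMagma = record { isEquivalence = isEquivalence′ ; ∙-cong = *-cong′ }
          ; assoc   = λ x y z → ≈⇒∼ (*-assoc x y z) }
        ; identityˡ = ≈⇒∼ ∘ *-identityˡ
        ; comm      = λ x y → ≈⇒∼ (*-comm x y) }
      ; distribʳ = λ x y z → ≈⇒∼ (distribʳ x y z)
      ; zeroˡ    = ≈⇒∼ ∘ zeroˡ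
      }
    }

module _ {c ℓ} (R : CommutativeSemiring c ℓ) where
  open CommutativeSemiring R renaming (trans to ≈-trans; zero to *-zero)
  open import Algebra.Properties.Semiring.Mult semiring using (_×_; ×-congˡ; ×-congʳ; ×-assoc-*; ×1-homo-*)
  open import Algebra.Properties.Semiring.Exp semiring using (_^_; ^-congʳ)
  open import Algebra.Properties.Semiring.Sum semiring using (sum; sum-init-last; sum-cong-≋; sum-replicate-zero)
  open import Algebra.Properties.CommutativeSemiring.Binomial R using (theorem; binomialTerm)
  open import Relation.Binary.Reasoning.Setoid setoid

  freshmansDream : ∀ {p} → Prime p → p × 1# ≈ 0# → ∀ x y → (x + y) ^ p ≈ x ^ p + y ^ p
  freshmansDream {0} p-prime = ⊥-elim (¬prime[0] p-prime)
  freshmansDream {1} p-prime = ⊥-elim (¬prime[1] p-prime)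
  freshmansDream {suc (suc m)} p-prime p×1≈0 x y = begin
    (x + y) ^ p                                            ≈⟨ theorem p x y ⟩
    term zero + sum (tail term)                            ≈⟨ +-congˡ (sum-init-last (tail term)) ⟩
    term zero + (sum (init (tail term)) + term (fromℕ p))  ≈⟨ +-congˡ (+-congʳ middle≈0) ⟩
    term zero + (0# + term (fromℕ p))                      ≈⟨ +-cong first≈yᵖ (≈-trans (+-identityˡ _) last≈xᵖ) ⟩
    y ^ p + x ^ p                                          ≈⟨ +-comm _ _ ⟩
    x ^ p + y ^ p                                          ∎
    where
    p = suc (suc m)
    term = binomialTerm x y p

    multiple≈0 : ∀ {c} → p ∣ℕ c → ∀ z → c × z ≈ 0#
    multiple≈0 (ℕ∣.divides q refl) z = begin
      (q ℕ.* p) × z                ≈⟨ ×-congʳ (q ℕ.* p) (*-identityˡ z) ⟨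
      (q ℕ.* p) × (1# * z)         ≈⟨ ×-assoc-* (q ℕ.* p) 1# z ⟨
      ((q ℕ.* p) × 1#) * z         ≈⟨ *-congʳ (×1-homo-* q p) ⟩
      ((q × 1#) * (p × 1#)) * z    ≈⟨ *-congʳ (*-congˡ p×1≈0) ⟩
      ((q × 1#) * 0#) * z          ≈⟨ *-congʳ (zeroʳ _) ⟩
      0# * z                       ≈⟨ zeroˡ z ⟩
      0#                           ∎

    middle≈0 : sum (init (tail term)) ≈ 0#
    middle≈0 = ≈-trans (sum-cong-≋ middle-term≈0) (sum-replicate-zero (suc m))
      where
      middle-term≈0 : ∀ i → term (suc (inject₁ i)) ≈ 0#
      middle-term≈0 i = multiple≈0 (prime∣C p-prime (s≤s z≤n) (s≤s (s≤s i≤m))) _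
        where i≤m = ℕP.≤-trans (ℕP.≤-reflexive (FinP.toℕ-inject₁ i)) (FinP.toℕ≤pred[n] i)

    first≈yᵖ : term zero ≈ y ^ p
    first≈yᵖ = ≈-trans (+-identityʳ _) (*-identityˡ _)

    last≈xᵖ : term (fromℕ p) ≈ x ^ p
    last≈xᵖ = top-term (toℕ (fromℕ p)) (FinP.toℕ-fromℕ p)
      where
      top-term : ∀ k → k ≡ p → (p C k) × (x ^ k * y ^ (p ℕ.∸ k)) ≈ x ^ p
      top-term _ refl = begin
        (p C p) × (x ^ p * y ^ (p ℕ.∸ p)) ≈⟨ ×-congˡ (nCn≡1 p) ⟩
        1 × (x ^ p * y ^ (p ℕ.∸ p))       ≈⟨ +-identityʳ _ ⟩
        x ^ p * y ^ (p ℕ.∸ p)             ≈⟨ *-congˡ (^-congʳ y (ℕP.n∸n≡0 p)) ⟩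
        x ^ p * 1#                        ≈⟨ *-identityʳ _ ⟩
        x ^ p                             ∎

open import Data.Integer using (-[1+_]; -1ℤ; _+_; _*_; _-_; -_; _^_)
open import Data.Product using (_×_; _,_; ∃; proj₁; proj₂)

private variable
  n : ℕ
  a b x y z m : ℤ

infix 4 _≡_mod_
record _≡_mod_ (x y m : ℤ) : Set where
  constructor mk≡mod
  field m∣x-y : m ∣ˢ x - y
open _≡_mod_

∣0 : ∀ m → m ∣ˢ + 0
∣0 m = divides (+ 0) (sym (ℤP.*-zeroˡ m))

≡mod-refl : x ≡ x mod m
≡mod-refl {x} {m} = mk≡mod (subst (_ ∣ˢ_) (sym (ℤP.+-inverseʳ x)) (∣0 m))

≡mod-reflexive : x ≡ y → x ≡ y mod m
≡mod-reflexive refl = ≡mod-refl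

≡mod-sym : x ≡ y mod m → y ≡ x mod m
≡mod-sym {x} {y} (mk≡mod m∣x-y) = mk≡mod (subst (_ ∣ˢ_) (negate x y) (ℤ∣.∣m⇒∣-m m∣x-y))
  where
  negate : ∀ x y → - (x - y) ≡ y - x
  negate = solve-∀

≡mod-trans : x ≡ y mod m → y ≡ z mod m → x ≡ z mod m
≡mod-trans {x} {y} {z = z} (mk≡mod m∣x-y) (mk≡mod m∣y-z) =
  mk≡mod (subst (_ ∣ˢ_) (telescope x y z) (ℤ∣.∣m∣n⇒∣m+n m∣x-y m∣y-z))
  where
  telescope : ∀ x y z → (x - y) + (y - z) ≡ x - z
  telescope = solve-∀

≡mod-isEquivalence : IsEquivalence (_≡_mod m)
≡mod-isEquivalence = record { refl = ≡mod-refl ; sym = ≡mod-sym ; trans = ≡mod-trans }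

+-cong-mod : x ≡ y mod m → a ≡ b mod m → x + a ≡ y + b mod m
+-cong-mod {x} {y} {a = a} {b} (mk≡mod m∣x-y) (mk≡mod m∣a-b) =
  mk≡mod (subst (_ ∣ˢ_) (regroup x y a b) (ℤ∣.∣m∣n⇒∣m+n m∣x-y m∣a-b))
  where
  regroup : ∀ x y a b → (x - y) + (a - b) ≡ (x + a) - (y + b)
  regroup = solve-∀

*-cong-mod : x ≡ y mod m → a ≡ b mod m → x * a ≡ y * b mod m
*-cong-mod {x} {y} {a = a} {b} (mk≡mod m∣x-y) (mk≡mod m∣a-b) =
  mk≡mod (subst (_ ∣ˢ_) (regroup x y a b)
                (ℤ∣.∣m∣n⇒∣m+n (ℤ∣.∣m⇒∣m*n a m∣x-y) (ℤ∣.∣n⇒∣m*n y m∣a-b)))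
  where
  regroup : ∀ x y a b → (x - y) * a + y * (a - b) ≡ x * a - y * b
  regroup = solve-∀

^-cong-mod : ∀ n → x ≡ y mod m → x ^ n ≡ y ^ n mod m
^-cong-mod zero    x≡y = ≡mod-refl
^-cong-mod (suc n) x≡y = *-cong-mod x≡y (^-cong-mod n x≡y)

≡+*⇒≡mod : ∀ {q} → x ≡ y + q * m → x ≡ y mod m
≡+*⇒≡mod {y = y} {m} {q} refl = mk≡mod (divides q (cancel y q m))
  where
  cancel : ∀ y q m → y + q * m - y ≡ q * m
  cancel = solve-∀

≡0mod-self : m ≡ + 0 mod m
≡0mod-self {m} = mk≡mod (divides (+ 1) (trans (ℤP.+-identityʳ m) (sym (ℤP.*-identityˡ m))))

∣⇒≡0mod : m ∣ˢ x → x ≡ + 0 mod m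
∣⇒≡0mod {x = x} m∣x = mk≡mod (subst (_ ∣ˢ_) (sym (ℤP.+-identityʳ x)) m∣x)

≡0mod⇒∣ : x ≡ + 0 mod m → m ∣ˢ x
≡0mod⇒∣ {x} (mk≡mod m∣x-0) = subst (_ ∣ˢ_) (ℤP.+-identityʳ x) m∣x-0

≡%ℕ : ∀ a d .{{_ : ℕ.NonZero d}} → a ≡ + (a ℤ.%ℕ d) mod + d
≡%ℕ a d = ≡+*⇒≡mod {q = a ℤ./ℕ d} (a≡a%ℕn+[a/ℕn]*n a d)

ℤ/_ : ℤ → CommutativeSemiring 0ℓ 0ℓ
ℤ/ m = quotientCommutativeSemiring ℤP.+-*-commutativeSemiring (≡mod-isEquivalence {m})
         ≡mod-reflexive +-cong-mod *-cong-mod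

0<n<p⇒∤ : ∀ {p n} → 0 < n → n < p → ¬ + p ∣ˢ + n
0<n<p⇒∤ 0<n n<p p∣n = ℕ∣.>⇒∤ {{ℕ.>-nonZero 0<n}} n<p (ℤ∣.∣⇒∣ᵤ p∣n)

module _ {p : ℕ} (p-prime : Prime p) where

  ∣*⇒∣⊎∣ : + p ∣ˢ a * b → + p ∣ˢ a ⊎ + p ∣ˢ b
  ∣*⇒∣⊎∣ {a} {b} p∣ab
    with euclidsLemma ℤ.∣ a ∣ ℤ.∣ b ∣ p-prime (subst (p ∣ℕ_) (ℤP.abs-* a b) (ℤ∣.∣⇒∣ᵤ p∣ab))
  ... | inj₁ p∣a = inj₁ (ℤ∣.∣ᵤ⇒∣ p∣a)
  ... | inj₂ p∣b = inj₂ (ℤ∣.∣ᵤ⇒∣ p∣b)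

  ∣*∧∤⇒∣ : + p ∣ˢ a * b → ¬ + p ∣ˢ a → + p ∣ˢ b
  ∣*∧∤⇒∣ p∣ab p∤a = [ (λ p∣a → ⊥-elim (p∤a p∣a)) , (λ p∣b → p∣b) ]′ (∣*⇒∣⊎∣ p∣ab)

  ∤*∤⇒∤* : ¬ + p ∣ˢ a → ¬ + p ∣ˢ b → ¬ + p ∣ˢ a * b
  ∤*∤⇒∤* p∤a p∤b p∣ab = p∤b (∣*∧∤⇒∣ p∣ab p∤a)

  prime∤1 : ¬ + p ∣ˢ + 1
  prime∤1 p∣1 = ¬prime[1] (subst Prime (ℕ∣.∣1⇒≡1 (ℤ∣.∣⇒∣ᵤ p∣1)) p-prime)

module Fermat {n} (p-prime : Prime (suc n)) where
  private
    p : ℕ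
    p = suc n
    open CommutativeSemiring (ℤ/ (+ p)) using (setoid; semiring; +-cong)
    open import Algebra.Properties.Semiring.Exp semiring using () renaming (_^_ to _^ₚ_)
    open import Algebra.Properties.Semiring.Mult semiring using () renaming (_×_ to _×ₚ_)
    open import Relation.Binary.Reasoning.Setoid setoid

    ^ₚ≡^ : ∀ x k → x ^ₚ k ≡ x ^ k
    ^ₚ≡^ x zero    = refl
    ^ₚ≡^ x (suc k) = cong (x *_) (^ₚ≡^ x k)

    ×ₚ1≡ : ∀ k → k ×ₚ + 1 ≡ + k
    ×ₚ1≡ zero    = refl
    ×ₚ1≡ (suc k) = cong (λ i → + 1 + i) (×ₚ1≡ k)

    fermat-ℕ : ∀ k → (+ k) ^ p ≡ + k mod + p
    fermat-ℕ zero    = ≡mod-refl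
    fermat-ℕ (suc k) = begin
      (+ 1 + + k) ^ p             ≡⟨ ^ₚ≡^ (+ 1 + + k) p ⟨
      (+ 1 + + k) ^ₚ p            ≈⟨ freshmansDream (ℤ/ (+ p)) p-prime p×1≡0 (+ 1) (+ k) ⟩
      (+ 1) ^ₚ p + (+ k) ^ₚ p     ≡⟨ cong₂ _+_ (^ₚ≡^ (+ 1) p) (^ₚ≡^ (+ k) p) ⟩
      (+ 1) ^ p + (+ k) ^ p       ≈⟨ +-cong (≡mod-reflexive (ℤP.^-zeroˡ p)) (fermat-ℕ k) ⟩
      + 1 + + k                   ∎
      where
      p×1≡0 : p ×ₚ + 1 ≡ + 0 mod + p
      p×1≡0 = ≡mod-trans (≡mod-reflexive (×ₚ1≡ p)) ≡0mod-self

  fermat : ∀ a → a ^ p ≡ a mod + p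
  fermat a = begin
    a ^ p                 ≈⟨ ^-cong-mod p (≡%ℕ a p) ⟩
    (+ (a ℤ.%ℕ p)) ^ p    ≈⟨ fermat-ℕ (a ℤ.%ℕ p) ⟩
    + (a ℤ.%ℕ p)          ≈⟨ ≡mod-sym (≡%ℕ a p) ⟩
    a                     ∎

  fermat-unit : ¬ + p ∣ˢ a → a ^ n ≡ + 1 mod + p
  fermat-unit {a} p∤a =
    mk≡mod (∣*∧∤⇒∣ p-prime {a = a} (subst (_ ∣ˢ_) (factor a (a ^ n)) (m∣x-y (fermat a))) p∤a)
    where
    factor : ∀ a x → a * x - a ≡ a * (x - + 1)
    factor = solve-∀

-- A pair (a , b) stands for a + b √D.
module QuadraticIntegers (D : ℤ) where

  infixl 6 _⊕_
  infixl 7 _⊗_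

  _⊕_ : ℤ × ℤ → ℤ × ℤ → ℤ × ℤ
  (a , b) ⊕ (c , d) = (a + c , b + d)

  _⊗_ : ℤ × ℤ → ℤ × ℤ → ℤ × ℤ
  (a , b) ⊗ (c , d) = (a * c + D * (b * d) , a * d + b * c)

  ⊕-assoc : ∀ x y z → (x ⊕ y) ⊕ z ≡ x ⊕ (y ⊕ z)
  ⊕-assoc (a , b) (c , d) (e , f) = cong₂ _,_ (ℤP.+-assoc a c e) (ℤP.+-assoc b d f)

  ⊕-identityˡ : ∀ x → (+ 0 , + 0) ⊕ x ≡ x
  ⊕-identityˡ (a , b) = cong₂ _,_ (ℤP.+-identityˡ a) (ℤP.+-identityˡ b)

  ⊕-comm : ∀ x y → x ⊕ y ≡ y ⊕ x
  ⊕-comm (a , b) (c , d) = cong₂ _,_ (ℤP.+-comm a c) (ℤP.+-comm b d)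

  ⊗-assoc : ∀ x y z → (x ⊗ y) ⊗ z ≡ x ⊗ (y ⊗ z)
  ⊗-assoc (a , b) (c , d) (e , f) = cong₂ _,_ (rational D a b c d e f) (irrational D a b c d e f)
    where
    rational : ∀ D a b c d e f → (a * c + D * (b * d)) * e + D * ((a * d + b * c) * f)
                                ≡ a * (c * e + D * (d * f)) + D * (b * (c * f + d * e))
    rational = solve-∀
    irrational : ∀ D a b c d e f → (a * c + D * (b * d)) * f + (a * d + b * c) * e
                                  ≡ a * (c * f + d * e) + b * (c * e + D * (d * f))
    irrational = solve-∀

  ⊗-identityˡ : ∀ x → (+ 1 , + 0) ⊗ x ≡ x
  ⊗-identityˡ (a , b) = cong₂ _,_ (rational D a b) (irrational a b)
    where
    rational : ∀ D a b → + 1 * a + D * (+ 0 * b) ≡ a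
    rational = solve-∀
    irrational : ∀ a b → + 1 * b + + 0 * a ≡ b
    irrational = solve-∀

  ⊗-comm : ∀ x y → x ⊗ y ≡ y ⊗ x
  ⊗-comm (a , b) (c , d) = cong₂ _,_ (rational D a b c d) (irrational a b c d)
    where
    rational : ∀ D a b c d → a * c + D * (b * d) ≡ c * a + D * (d * b)
    rational = solve-∀
    irrational : ∀ a b c d → a * d + b * c ≡ c * b + d * a
    irrational = solve-∀

  ⊗-distribʳ-⊕ : ∀ x y z → (y ⊕ z) ⊗ x ≡ y ⊗ x ⊕ z ⊗ x
  ⊗-distribʳ-⊕ (a , b) (c , d) (e , f) = cong₂ _,_ (rational D a b c d e f) (irrational a b c d e f)
    where
    rational : ∀ D a b c d e f → (c + e) * a + D * ((d + f) * b) ≡ (c * a + D * (d * b)) + (e * a + D * (f * b))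
    rational = solve-∀
    irrational : ∀ a b c d e f → (c + e) * b + (d + f) * a ≡ (c * b + d * a) + (e * b + f * a)
    irrational = solve-∀

  ⊗-zeroˡ : ∀ x → (+ 0 , + 0) ⊗ x ≡ (+ 0 , + 0)
  ⊗-zeroˡ (a , b) = cong₂ _,_ (rational D a b) (irrational a b)
    where
    rational : ∀ D a b → + 0 * a + D * (+ 0 * b) ≡ + 0
    rational = solve-∀
    irrational : ∀ a b → + 0 * b + + 0 * a ≡ + 0
    irrational = solve-∀

  ℤ[√D] : CommutativeSemiring 0ℓ 0ℓ
  ℤ[√D] = record
    { _≈_ = _≡_ ; _+_ = _⊕_ ; _*_ = _⊗_ ; 0# = + 0 , + 0 ; 1# = + 1 , + 0
    ; isCommutativeSemiring = IsCommutativeSemiringˡ.isCommutativeSemiring record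
      { +-isCommutativeMonoid = isCommutativeMonoidˡ record
        { isSemigroup = record
          { isMagma = record { isEquivalence = ≡.isEquivalence ; ∙-cong = cong₂ _⊕_ }
          ; assoc   = ⊕-assoc }
        ; identityˡ = ⊕-identityˡ
        ; comm      = ⊕-comm }
      ; *-isCommutativeMonoid = isCommutativeMonoidˡ record
        { isSemigroup = record
          { isMagma = record { isEquivalence = ≡.isEquivalence ; ∙-cong = cong₂ _⊗_ }
          ; assoc   = ⊗-assoc }
        ; identityˡ = ⊗-identityˡ
        ; comm      = ⊗-comm }
      ; distribʳ = ⊗-distribʳ-⊕
      ; zeroˡ    = ⊗-zeroˡ
      }
    }

  module _ (m : ℤ) where

    _≈ₘ_ : Rel (ℤ × ℤ) 0ℓ
    _≈ₘ_ = Pointwise (_≡_mod m) (_≡_mod m)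

    ⊗-cong-mod : _⊗_ Preserves₂ _≈ₘ_ ⟶ _≈ₘ_ ⟶ _≈ₘ_
    ⊗-cong-mod {a , b} {a′ , b′} {c , d} {c′ , d′} (a≡a′ , b≡b′) (c≡c′ , d≡d′) =
      +-cong-mod (*-cong-mod a≡a′ c≡c′) (*-cong-mod (≡mod-refl {D}) (*-cong-mod b≡b′ d≡d′)) ,
      +-cong-mod (*-cong-mod a≡a′ d≡d′) (*-cong-mod b≡b′ c≡c′)

    ℤ[√D]/_ : CommutativeSemiring 0ℓ 0ℓ
    ℤ[√D]/_ = quotientCommutativeSemiring ℤ[√D] (×-isEquivalence ≡mod-isEquivalence ≡mod-isEquivalence)
      (λ { refl → ≡mod-refl , ≡mod-refl })
      (λ (a≡a′ , b≡b′) (c≡c′ , d≡d′) → +-cong-mod a≡a′ c≡c′ , +-cong-mod b≡b′ d≡d′)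
      ⊗-cong-mod

infixl 5 _·X+_

data Monic : ℕ → Set where
  1ₘ    : Monic 0
  _·X+_ : Monic n → ℤ → Monic (suc n)

eval : Monic n → ℤ → ℤ
eval 1ₘ        x = + 1
eval (f ·X+ c) x = eval f x * x + c

_÷X-_ : Monic (suc n) → ℤ → Monic n
(1ₘ ·X+ _)          ÷X- r = 1ₘ
(f@(_ ·X+ _) ·X+ _) ÷X- r = (f ÷X- r) ·X+ eval f r

eval-÷X- : ∀ (f : Monic (suc n)) x r → eval f x - eval f r ≡ (x - r) * eval (f ÷X- r) x
eval-÷X- (1ₘ ·X+ c) x r = linear x r c
  where
  linear : ∀ x r c → (+ 1 * x + c) - (+ 1 * r + c) ≡ (x - r) * + 1
  linear = solve-∀
eval-÷X- (f@(_ ·X+ _) ·X+ c) x r = begin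
  (eval f x * x + c) - (eval f r * r + c)              ≡⟨ expand (eval f x) (eval f r) x r c ⟩
  (eval f x - eval f r) * x + eval f r * (x - r)       ≡⟨ cong (λ t → t * x + eval f r * (x - r)) (eval-÷X- f x r) ⟩
  (x - r) * eval (f ÷X- r) x * x + eval f r * (x - r)  ≡⟨ collect (x - r) (eval (f ÷X- r) x) x (eval f r) ⟩
  (x - r) * (eval (f ÷X- r) x * x + eval f r)          ∎
  where
  open ≡-Reasoning
  expand : ∀ u v x r c → (u * x + c) - (v * r + c) ≡ (u - v) * x + v * (x - r)
  expand = solve-∀
  collect : ∀ d q x v → d * q * x + v * d ≡ d * (q * x + v)
  collect = solve-∀

Xⁿ : ∀ n → Monic n
Xⁿ zero    = 1ₘ
Xⁿ (suc n) = Xⁿ n ·X+ + 0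

eval-Xⁿ : ∀ n x → eval (Xⁿ n) x ≡ x ^ n
eval-Xⁿ zero    x = refl
eval-Xⁿ (suc n) x = trans (ℤP.+-identityʳ _) (trans (cong (_* x) (eval-Xⁿ n x)) (ℤP.*-comm (x ^ n) x))

X^[_]-1 : ∀ k .{{_ : ℕ.NonZero k}} → Monic k
X^[ suc k ]-1 = Xⁿ k ·X+ -1ℤ

eval-X^[]-1 : ∀ k .{{_ : ℕ.NonZero k}} x → eval X^[ k ]-1 x ≡ x ^ k - + 1
eval-X^[]-1 (suc k) x = cong (_+ -1ℤ) (trans (cong (_* x) (eval-Xⁿ k x)) (ℤP.*-comm (x ^ k) x))

roots≤degree : ∀ {p} → Prime p → ∀ (f : Monic n) rs → AllPairs (λ r s → ¬ r ≡ s mod + p) rs →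
               All (λ r → + p ∣ˢ eval f r) rs → length rs ≤ n
roots≤degree     p-prime f         []       _                    _                 = z≤n
roots≤degree     p-prime 1ₘ        (r ∷ rs) _                    (p∣1 ∷ _)         = ⊥-elim (prime∤1 p-prime p∣1)
roots≤degree {p = p} p-prime (f ·X+ c) (r ∷ rs) (r≢rs ∷ rs-distinct) (p∣fr ∷ p∣f[rs]) =
  s≤s (roots≤degree p-prime ((f ·X+ c) ÷X- r) rs rs-distinct (All.zipWith root-of-quotient (r≢rs , p∣f[rs])))
  where
  root-of-quotient : ∀ {s} → ¬ r ≡ s mod + p × + p ∣ˢ eval (f ·X+ c) s → + p ∣ˢ eval ((f ·X+ c) ÷X- r) s
  root-of-quotient {s} (r≢s , p∣fs) =
    ∣*∧∤⇒∣ p-prime {a = s - r} (subst (_ ∣ˢ_) (eval-÷X- (f ·X+ c) s r) (ℤ∣.∣m∣n⇒∣m-n p∣fs p∣fr))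
           (λ p∣s-r → r≢s (≡mod-sym (mk≡mod p∣s-r)))

^-distribʳ-* : ∀ x y n → (x * y) ^ n ≡ x ^ n * y ^ n
^-distribʳ-* x y zero    = refl
^-distribʳ-* x y (suc n) = trans (cong ((x * y) *_) (^-distribʳ-* x y n)) (interchange x y (x ^ n) (y ^ n))
  where
  interchange : ∀ a b c d → a * b * (c * d) ≡ a * c * (b * d)
  interchange = solve-∀

module Euler {k} (p-prime : Prime (suc (k ℕ.+ k))) {a} (p∤a : ¬ + suc (k ℕ.+ k) ∣ˢ a) where
  private
    p : ℕ
    p = suc (k ℕ.+ k)
    open Fermat p-prime

    instance
      k≢0 : ℕ.NonZero k
      k≢0 = ℕ.≢-nonZero λ { refl → ¬prime[1] p-prime }

    ≤k⇒<p : ∀ {i} → i ≤ k → i < p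
    ≤k⇒<p i≤k = s≤s (ℕP.≤-trans i≤k (ℕP.m≤m+n k k))

    square^k≡1 : ¬ + p ∣ˢ x → (x * x) ^ k ≡ + 1 mod + p
    square^k≡1 {x} p∤x = ≡mod-trans (≡mod-reflexive (trans (^-distribʳ-* x x k) (sym (ℤP.^-distribˡ-+-* x k k))))
                                   (fermat-unit p∤x)

    squares-incongruent : ∀ {i j} → 0 < i → i < j → j ≤ k → ¬ + i * + i ≡ + j * + j mod + p
    squares-incongruent {i} {j} 0<i i<j j≤k i²≡j²
      with ∣*⇒∣⊎∣ p-prime (subst (_ ∣ˢ_) (difference-of-squares (+ j) (+ i)) (m∣x-y (≡mod-sym i²≡j²)))
      where
      difference-of-squares : ∀ x y → x * x - y * y ≡ (x - y) * (x + y)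
      difference-of-squares = solve-∀
    ... | inj₁ p∣j-i = 0<n<p⇒∤ (ℕP.m<n⇒0<n∸m i<j) (≤k⇒<p (ℕP.≤-trans (ℕP.m∸n≤m j i) j≤k))
                         (subst (_ ∣ˢ_) (trans (ℤP.[+m]-[+n]≡m⊖n j i) (ℤP.⊖-≥ (ℕP.<⇒≤ i<j))) p∣j-i)
    ... | inj₂ p∣j+i = 0<n<p⇒∤ (ℕP.<-≤-trans 0<i (ℕP.m≤n+m i j))
                         (s≤s (ℕP.+-mono-≤ j≤k (ℕP.≤-trans (ℕP.<⇒≤ i<j) j≤k))) p∣j+i

  euler-residue : ∀ x → + p ∣ˢ x * x - a → a ^ k ≡ + 1 mod + p
  euler-residue x p∣x²-a = ≡mod-trans (^-cong-mod k (≡mod-sym (mk≡mod p∣x²-a))) (square^k≡1 p∤x)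
    where
    cancel : ∀ x a → x * x - (x * x - a) ≡ a
    cancel = solve-∀
    p∤x : ¬ + p ∣ˢ x
    p∤x p∣x = p∤a (subst (_ ∣ˢ_) (cancel x a) (ℤ∣.∣m∣n⇒∣m-n (ℤ∣.∣m⇒∣m*n x p∣x) p∣x²-a))

  euler-nonresidue : (∀ x → x < p → ¬ + p ∣ˢ + x * + x - a) → a ^ k ≡ -1ℤ mod + p
  euler-nonresidue nonresidue with ∣*⇒∣⊎∣ p-prime p∣[aᵏ-1][aᵏ+1]
    where
    factor : ∀ y → y * y - + 1 ≡ (y - + 1) * (y + + 1)
    factor = solve-∀
    p∣[aᵏ-1][aᵏ+1] : + p ∣ˢ (a ^ k - + 1) * (a ^ k + + 1)
    p∣[aᵏ-1][aᵏ+1] = subst (_ ∣ˢ_) (trans (cong (_- + 1) (ℤP.^-distribˡ-+-* a k k)) (factor (a ^ k)))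
                       (m∣x-y (fermat-unit p∤a))
  ... | inj₂ p∣aᵏ+1 = mk≡mod p∣aᵏ+1
  ... | inj₁ p∣aᵏ-1 = ⊥-elim (ℕP.<-irrefl refl k+1≤k)
    where
    squares = applyUpTo (λ i → + suc i * + suc i) k

    incongruent : AllPairs (λ r s → ¬ r ≡ s mod + p) (a ∷ squares)
    incongruent =
      All.applyUpTo⁺₁ _ k (λ {i} i<k a≡i² → nonresidue (suc i) (≤k⇒<p i<k) (m∣x-y (≡mod-sym a≡i²))) ∷
      AllPairs.applyUpTo⁺₁ _ k (λ i<j j<k → squares-incongruent (s≤s z≤n) (s≤s i<j) j<k)

    roots : All (λ r → + p ∣ˢ eval X^[ k ]-1 r) (a ∷ squares)
    roots =
      subst (_ ∣ˢ_) (sym (eval-X^[]-1 k a)) p∣aᵏ-1 ∷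
      All.applyUpTo⁺₁ _ k (λ {i} i<k → subst (_ ∣ˢ_) (sym (eval-X^[]-1 k _))
                                             (m∣x-y (square^k≡1 (0<n<p⇒∤ (s≤s z≤n) (≤k⇒<p i<k)))))

    k+1≤k : suc k ≤ k
    k+1≤k = subst (λ l → suc l ≤ k) (length-applyUpTo _ k)
                  (roots≤degree p-prime X^[ k ]-1 (a ∷ squares) incongruent roots)

∣⇒%ℕ≡0 : ∀ a d .{{_ : ℕ.NonZero d}} → + d ∣ˢ a → a ℤ.%ℕ d ≡ 0
∣⇒%ℕ≡0 a d d∣a = trans (sym (m<n⇒m%n≡m (n%ℕd<d a d))) (n∣m⇒m%n≡0 _ d (ℤ∣.∣⇒∣ᵤ d∣r))
  where
  d∣r : + d ∣ˢ + (a ℤ.%ℕ d)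
  d∣r = ≡0mod⇒∣ (≡mod-trans (≡mod-sym (≡%ℕ a d)) (∣⇒≡0mod d∣a))

%ℕ≡0⇒∣ : ∀ a d .{{_ : ℕ.NonZero d}} → a ℤ.%ℕ d ≡ 0 → + d ∣ˢ a
%ℕ≡0⇒∣ a d a%d≡0 = ≡0mod⇒∣ (≡mod-trans (≡%ℕ a d) (≡mod-reflexive (cong +_ a%d≡0)))

isSquareRoot : ℤ → (p : ℕ) .{{_ : ℕ.NonZero p}} → ℕ → Bool
isSquareRoot a p x = ⌊ ((+ x * + x - a) ℤ.%ℕ p) ℕ.≟ 0 ⌋

legendre-dichotomy : ∀ a {p} → Prime p → ¬ + p ∣ˢ a →
    (legendre a p ≡ + 1 × ∃ λ x → + p ∣ˢ + x * + x - a)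
  ⊎ (legendre a p ≡ -1ℤ × ∀ x → x < p → ¬ + p ∣ˢ + x * + x - a)
legendre-dichotomy a {suc m} _ p∤a with (a ℤ.%ℕ suc m) ℕ.≟ 0
... | yes a%p≡0 = ⊥-elim (p∤a (%ℕ≡0⇒∣ a (suc m) a%p≡0))
... | no _ with any (λ x → ⌊ ((+ x * + x - a) ℤ.%ℕ suc m) ℕ.≟ 0 ⌋) (upTo (suc m)) in any≡
...   | true  = inj₁ (refl , root)
  where
  root : ∃ λ x → + suc m ∣ˢ + x * + x - a
  root with satisfied (any⁻ (isSquareRoot a (suc m)) (upTo (suc m)) (subst T (sym any≡) tt))
  ... | x , p∣x²-a = x , %ℕ≡0⇒∣ _ (suc m) (toWitness p∣x²-a)
...   | false = inj₂ (refl , λ x x<p p∣x²-a →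
  subst T any≡ (any⁺ (isSquareRoot a (suc m)) (lose (∈-upTo⁺ x<p) (fromWitness (∣⇒%ℕ≡0 _ (suc m) p∣x²-a)))))

∣-quadratic : ∀ c d → m ∣ˢ a → m ∣ˢ b → m * m ∣ˢ a * a + c * a * b + d * b * b
∣-quadratic {m} c d (divides qa refl) (divides qb refl) = divides (qa * qa + c * qa * qb + d * qb * qb) (scale c d qa qb m)
  where
  scale : ∀ c d qa qb m → (qa * m) * (qa * m) + c * (qa * m) * (qb * m) + d * (qb * m) * (qb * m)
                        ≡ (qa * qa + c * qa * qb + d * qb * qb) * (m * m)
  scale = solve-∀

odd-prime>2 : ∀ {k} → Prime (suc (k ℕ.+ k)) → 2 < suc (k ℕ.+ k)
odd-prime>2 {zero}  p-prime = ⊥-elim (¬prime[1] p-prime)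
odd-prime>2 {suc k} _       = s≤s (s≤s (ℕP.≤-trans (s≤s z≤n) (ℕP.m≤n+m (suc k) k)))

module _ (A B : ℤ) where
  private
    u = lucasU A B

  lucasU-recurrence : ∀ n → u (suc (suc n)) ≡ A * u (suc n) - B * u n
  lucasU-recurrence n = refl

  cassini : ∀ n → u (suc n) * u (suc n) + A * u (suc n) * - u n + B * - u n * - u n ≡ B ^ n
  cassini zero    = base A B
    where
    base : ∀ A B → + 1 * + 1 + A * + 1 * - + 0 + B * - + 0 * - + 0 ≡ + 1
    base = solve-∀
  cassini (suc n) = begin
    u (suc (suc n)) * u (suc (suc n)) + A * u (suc (suc n)) * - u (suc n) + B * - u (suc n) * - u (suc n)
      ≡⟨ cong (λ v → v * v + A * v * - u (suc n) + B * - u (suc n) * - u (suc n)) (lucasU-recurrence n) ⟩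
    (A * u (suc n) - B * u n) * (A * u (suc n) - B * u n) + A * (A * u (suc n) - B * u n) * - u (suc n)
      + B * - u (suc n) * - u (suc n)
      ≡⟨ step A B (u (suc n)) (u n) ⟩
    B * (u (suc n) * u (suc n) + A * u (suc n) * - u n + B * - u n * - u n)
      ≡⟨ cong (B *_) (cassini n) ⟩
    B * B ^ n ∎
    where
    open ≡-Reasoning
    step : ∀ A B u₁ u₀ → (A * u₁ - B * u₀) * (A * u₁ - B * u₀) + A * (A * u₁ - B * u₀) * - u₁ + B * - u₁ * - u₁
                        ≡ B * (u₁ * u₁ + A * u₁ * - u₀ + B * - u₀ * - u₀)
    step = solve-∀

module LucasModPrime (A B : ℤ) {k} (p-prime : Prime (suc (k ℕ.+ k))) where
  private
    p : ℕ
    p = suc (k ℕ.+ k)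
    Δ = A * A - + 4 * B
    u = lucasU A B
    open QuadraticIntegers Δ
    open CommutativeSemiring (ℤ[√D]/ (+ p)) using (semiring) renaming (_≈_ to _≈ᴿ_)
    open import Algebra.Properties.Semiring.Exp semiring using () renaming (_^_ to _^ᴿ_)
    open import Algebra.Properties.Semiring.Mult semiring using () renaming (_×_ to _×ᴿ_)

    √Δ : ℤ × ℤ
    √Δ = + 0 , + 1

    A+√Δ^ : ∀ m → (A , + 1) ^ᴿ suc m ≡ ((+ 2) ^ m * (A * u (suc m) - + 2 * B * u m) , (+ 2) ^ m * u (suc m))
    A+√Δ^ zero    = cong₂ _,_ (rational A B) (irrational A)
      where
      rational : ∀ A B → A * + 1 + (A * A - + 4 * B) * (+ 1 * + 0) ≡ + 1 * (A * + 1 - + 2 * B * + 0)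
      rational = solve-∀
      irrational : ∀ A → A * + 0 + + 1 * + 1 ≡ + 1 * + 1
      irrational = solve-∀
    A+√Δ^ (suc m) = trans (cong ((A , + 1) ⊗_) (A+√Δ^ m))
                          (cong₂ _,_ (rational A B ((+ 2) ^ m) (u (suc m)) (u m)) (irrational A B ((+ 2) ^ m) (u (suc m)) (u m)))
      where
      rational : ∀ A B t u₁ u₀ → A * (t * (A * u₁ - + 2 * B * u₀)) + (A * A - + 4 * B) * (+ 1 * (t * u₁))
                               ≡ (+ 2 * t) * (A * (A * u₁ - B * u₀) - + 2 * B * u₁)
      rational = solve-∀
      irrational : ∀ A B t u₁ u₀ → A * (t * u₁) + + 1 * (t * (A * u₁ - + 2 * B * u₀)) ≡ (+ 2 * t) * (A * u₁ - B * u₀)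
      irrational = solve-∀

    √Δ^even : ∀ j → √Δ ^ᴿ (j ℕ.+ j) ≡ (Δ ^ j , + 0)
    √Δ^even zero    = refl
    √Δ^even (suc j) rewrite ℕP.+-suc j j | √Δ^even j = cong₂ _,_ (rational Δ (Δ ^ j)) (irrational Δ (Δ ^ j))
      where
      rational : ∀ D x → + 0 * (+ 0 * x + D * (+ 1 * + 0)) + D * (+ 1 * (+ 0 * + 0 + + 1 * x)) ≡ D * x
      rational = solve-∀
      irrational : ∀ D x → + 0 * (+ 0 * + 0 + + 1 * x) + + 1 * (+ 0 * x + D * (+ 1 * + 0)) ≡ + 0
      irrational = solve-∀

    √Δ^p : √Δ ^ᴿ p ≡ (+ 0 , Δ ^ k)
    √Δ^p rewrite √Δ^even k = cong₂ _,_ (rational Δ (Δ ^ k)) (irrational (Δ ^ k))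
      where
      rational : ∀ D x → + 0 * x + D * (+ 1 * + 0) ≡ + 0
      rational = solve-∀
      irrational : ∀ x → + 0 * + 0 + + 1 * x ≡ x
      irrational = solve-∀

    A^ : ∀ m → (A , + 0) ^ᴿ m ≡ (A ^ m , + 0)
    A^ zero    = refl
    A^ (suc m) rewrite A^ m = cong₂ _,_ (rational Δ A (A ^ m)) (irrational A (A ^ m))
      where
      rational : ∀ D a x → a * x + D * (+ 0 * + 0) ≡ a * x
      rational = solve-∀
      irrational : ∀ a x → a * + 0 + + 0 * x ≡ + 0
      irrational = solve-∀

    ×ᴿ1 : ∀ n → n ×ᴿ (+ 1 , + 0) ≡ (+ n , + 0)
    ×ᴿ1 zero    = refl
    ×ᴿ1 (suc n) = cong ((+ 1 , + 0) ⊕_) (×ᴿ1 n)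

    frobenius : (+ 2) ^ (k ℕ.+ k) * (A * u p - + 2 * B * u (k ℕ.+ k)) ≡ A ^ p + + 0 mod + p
              × (+ 2) ^ (k ℕ.+ k) * u p ≡ + 0 + Δ ^ k mod + p
    frobenius = subst₂ _≈ᴿ_ (trans (cong (λ a → (a , + 1) ^ᴿ p) (ℤP.+-identityʳ A)) (A+√Δ^ (k ℕ.+ k)))
                            (cong₂ _⊕_ (A^ p) √Δ^p)
                            (freshmansDream (ℤ[√D]/ (+ p)) p-prime characteristic (A , + 0) √Δ)
      where
      characteristic : p ×ᴿ (+ 1 , + 0) ≈ᴿ (+ 0 , + 0)
      characteristic = subst (_≈ᴿ (+ 0 , + 0)) (sym (×ᴿ1 p)) (≡0mod-self , ≡mod-refl)

  lucas-mod-p : u p ≡ Δ ^ k mod + p × A * u p - + 2 * B * u (k ℕ.+ k) ≡ A mod + p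
  lucas-mod-p = uₚ≡Δᵏ , vₚ≡A
    where
    open Fermat p-prime using (fermat; fermat-unit)
    open import Relation.Binary.Reasoning.Setoid (CommutativeSemiring.setoid (ℤ/ (+ p)))
    1≡2ⁿ : + 1 ≡ (+ 2) ^ (k ℕ.+ k) mod + p
    1≡2ⁿ = ≡mod-sym (fermat-unit (0<n<p⇒∤ (s≤s z≤n) (odd-prime>2 {k} p-prime)))
    uₚ≡Δᵏ : u p ≡ Δ ^ k mod + p
    uₚ≡Δᵏ = begin
      u p                                   ≡⟨ ℤP.*-identityˡ (u p) ⟨
      + 1 * u p                             ≈⟨ *-cong-mod 1≡2ⁿ (≡mod-refl {u p}) ⟩
      (+ 2) ^ (k ℕ.+ k) * u p               ≈⟨ proj₂ frobenius ⟩
      + 0 + Δ ^ k                           ≡⟨ ℤP.+-identityˡ (Δ ^ k) ⟩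
      Δ ^ k                                 ∎
    vₚ≡A : A * u p - + 2 * B * u (k ℕ.+ k) ≡ A mod + p
    vₚ≡A = begin
      A * u p - + 2 * B * u (k ℕ.+ k)                        ≡⟨ ℤP.*-identityˡ _ ⟨
      + 1 * (A * u p - + 2 * B * u (k ℕ.+ k))                ≈⟨ *-cong-mod 1≡2ⁿ ≡mod-refl ⟩
      (+ 2) ^ (k ℕ.+ k) * (A * u p - + 2 * B * u (k ℕ.+ k))  ≈⟨ proj₁ frobenius ⟩
      A ^ p + + 0                                            ≡⟨ ℤP.+-identityʳ (A ^ p) ⟩
      A ^ p                                                  ≈⟨ fermat A ⟩
      A                                                      ∎

module _ (A B : ℤ) where
  private
    u = lucasU A B

  residue-identity : ∀ n →
    - ((B * u n + + 1) * (B * u n + + 1) + A * (B * u n + + 1) * - u (suc n) + B * - u (suc n) * - u (suc n))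
    ≡ + 2 * u (suc (suc n)) - A * u (suc n) - (B ^ suc n + + 1)
  residue-identity n = begin
    - ((B * u n + + 1) * (B * u n + + 1) + A * (B * u n + + 1) * - u (suc n) + B * - u (suc n) * - u (suc n))
      ≡⟨ expand A B (u (suc n)) (u n) ⟩
    + 2 * (A * u (suc n) - B * u n) - A * u (suc n)
      - (B * (u (suc n) * u (suc n) + A * u (suc n) * - u n + B * - u n * - u n) + + 1)
      ≡⟨ cong (λ t → + 2 * (A * u (suc n) - B * u n) - A * u (suc n) - (B * t + + 1)) (cassini A B n) ⟩
    + 2 * (A * u (suc n) - B * u n) - A * u (suc n) - (B * B ^ n + + 1)
      ≡⟨ cong (λ v → + 2 * v - A * u (suc n) - (B * B ^ n + + 1)) (lucasU-recurrence A B n) ⟨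
    + 2 * u (suc (suc n)) - A * u (suc n) - (B ^ suc n + + 1) ∎
    where
    open ≡-Reasoning
    expand : ∀ A B u₁ u₀ →
      - ((B * u₀ + + 1) * (B * u₀ + + 1) + A * (B * u₀ + + 1) * - u₁ + B * - u₁ * - u₁)
      ≡ + 2 * (A * u₁ - B * u₀) - A * u₁ - (B * (u₁ * u₁ + A * u₁ * - u₀ + B * - u₀ * - u₀) + + 1)
    expand = solve-∀

  nonresidue-identity : ∀ n →
    (A + B * u n) * (A + B * u n) + A * (A + B * u n) * - (u (suc n) + + 1) + B * - (u (suc n) + + 1) * - (u (suc n) + + 1)
    ≡ + 2 * B * u (suc n) - A * u (suc (suc n)) + B * (B ^ n + + 1)
  nonresidue-identity n = begin
    (A + B * u n) * (A + B * u n) + A * (A + B * u n) * - (u (suc n) + + 1) + B * - (u (suc n) + + 1) * - (u (suc n) + + 1)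
      ≡⟨ expand A B (u (suc n)) (u n) ⟩
    + 2 * B * u (suc n) - A * (A * u (suc n) - B * u n)
      + B * ((u (suc n) * u (suc n) + A * u (suc n) * - u n + B * - u n * - u n) + + 1)
      ≡⟨ cong (λ t → + 2 * B * u (suc n) - A * (A * u (suc n) - B * u n) + B * (t + + 1)) (cassini A B n) ⟩
    + 2 * B * u (suc n) - A * (A * u (suc n) - B * u n) + B * (B ^ n + + 1)
      ≡⟨ cong (λ v → + 2 * B * u (suc n) - A * v + B * (B ^ n + + 1)) (lucasU-recurrence A B n) ⟨
    + 2 * B * u (suc n) - A * u (suc (suc n)) + B * (B ^ n + + 1) ∎
    where
    open ≡-Reasoning
    expand : ∀ A B u₁ u₀ →
      (A + B * u₀) * (A + B * u₀) + A * (A + B * u₀) * - (u₁ + + 1) + B * - (u₁ + + 1) * - (u₁ + + 1)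
      ≡ + 2 * B * u₁ - A * (A * u₁ - B * u₀) + B * ((u₁ * u₁ + A * u₁ * - u₀ + B * - u₀ * - u₀) + + 1)
    expand = solve-∀

  residue⇒p²∣ : ∀ {n} → Prime (suc n) → ¬ + suc n ∣ˢ + 2 * B →
    u (suc n) ≡ + 1 mod + suc n → A * u (suc n) - + 2 * B * u n ≡ A mod + suc n →
    + suc n * + suc n ∣ˢ + 2 * u (suc n) - A * u n - (B ^ n + + 1)
  residue⇒p²∣ {zero}  p-prime = ⊥-elim (¬prime[1] p-prime)
  residue⇒p²∣ {suc n} p-prime p∤2B uₚ≡1 vₚ≡A =
    subst (_ ∣ˢ_) (residue-identity n) (ℤ∣.∣m⇒∣-m (∣-quadratic A B p∣Bu₀+1 (ℤ∣.∣m⇒∣-m p∣u₁)))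
    where
    cancel₁ : ∀ A B uₚ u₁ → (A * uₚ - A * + 1) - ((A * uₚ - + 2 * B * u₁) - A) ≡ + 2 * B * u₁
    cancel₁ = solve-∀
    p∣2Bu₁ : + suc (suc n) ∣ˢ + 2 * B * u (suc n)
    p∣2Bu₁ = subst (_ ∣ˢ_) (cancel₁ A B (u (suc (suc n))) (u (suc n)))
               (ℤ∣.∣m∣n⇒∣m-n (m∣x-y (*-cong-mod (≡mod-refl {A}) uₚ≡1)) (m∣x-y vₚ≡A))
    p∣u₁ : + suc (suc n) ∣ˢ u (suc n)
    p∣u₁ = ∣*∧∤⇒∣ p-prime {a = + 2 * B} p∣2Bu₁ p∤2B
    cancel₂ : ∀ A B u₁ u₀ → - (((A * u₁ - B * u₀) - + 1) - A * u₁) ≡ B * u₀ + + 1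
    cancel₂ = solve-∀
    p∣Bu₀+1 : + suc (suc n) ∣ˢ B * u n + + 1
    p∣Bu₀+1 = subst (_ ∣ˢ_) (trans (cong (λ v → - ((v - + 1) - A * u (suc n))) (lucasU-recurrence A B n))
                                  (cancel₂ A B (u (suc n)) (u n)))
                (ℤ∣.∣m⇒∣-m (ℤ∣.∣m∣n⇒∣m-n (m∣x-y uₚ≡1) (ℤ∣.∣n⇒∣m*n A p∣u₁)))

  nonresidue⇒p²∣ : ∀ {n} → Prime (suc n) → ¬ + suc n ∣ˢ + 2 * B →
    u (suc n) ≡ -1ℤ mod + suc n → A * u (suc n) - + 2 * B * u n ≡ A mod + suc n →
    + suc n * + suc n ∣ˢ + 2 * B * u (suc n) - A * u (suc (suc n)) + B * (B ^ n + + 1)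
  nonresidue⇒p²∣ {n} p-prime p∤2B uₚ≡-1 vₚ≡A =
    subst (_ ∣ˢ_) (nonresidue-identity n) (∣-quadratic A B p∣A+Bu₀ (ℤ∣.∣m⇒∣-m (m∣x-y uₚ≡-1)))
    where
    cancel : ∀ A B u₁ u₀ → A * (u₁ + + 1) - ((A * u₁ - + 2 * B * u₀) - A) ≡ + 2 * (A + B * u₀)
    cancel = solve-∀
    p∣2[A+Bu₀] : + suc n ∣ˢ + 2 * (A + B * u n)
    p∣2[A+Bu₀] = subst (_ ∣ˢ_) (cancel A B (u (suc n)) (u n))
                   (ℤ∣.∣m∣n⇒∣m-n (ℤ∣.∣n⇒∣m*n A (m∣x-y uₚ≡-1)) (m∣x-y vₚ≡A))
    p∣A+Bu₀ : + suc n ∣ˢ A + B * u n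
    p∣A+Bu₀ = ∣*∧∤⇒∣ p-prime {a = + 2} p∣2[A+Bu₀] (λ p∣2 → p∤2B (ℤ∣.∣m⇒∣m*n B p∣2))

ιℚᵘ : ∀ a → ℚ.toℚᵘ (ιℚ a) ≃ᵘ mkℚᵘ a 0
ιℚᵘ a = ℚP.toℚᵘ-fromℚᵘ (mkℚᵘ a 0)

ιℚ-+ : ∀ a b → ιℚ (a + b) ≡ ιℚ a ℚ.+ ιℚ b
ιℚ-+ a b = ℚP.toℚᵘ-injective (begin
  ℚ.toℚᵘ (ιℚ (a + b))                 ≈⟨ ιℚᵘ (a + b) ⟩
  mkℚᵘ (a + b) 0                       ≈⟨ *≡* (denominators-one a b) ⟩
  mkℚᵘ a 0 ℚᵘ.+ mkℚᵘ b 0               ≈⟨ ℚᵘP.+-cong (ιℚᵘ a) (ιℚᵘ b) ⟨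
  ℚ.toℚᵘ (ιℚ a) ℚᵘ.+ ℚ.toℚᵘ (ιℚ b)    ≈⟨ ℚP.toℚᵘ-homo-+ (ιℚ a) (ιℚ b) ⟨
  ℚ.toℚᵘ (ιℚ a ℚ.+ ιℚ b)              ∎)
  where
  open ℚᵘP.≃-Reasoning
  denominators-one : ∀ a b → (a + b) * + 1 ≡ (a * + 1 + b * + 1) * + 1
  denominators-one = solve-∀

ιℚ-* : ∀ a b → ιℚ (a * b) ≡ ιℚ a ℚ.* ιℚ b
ιℚ-* a b = ℚP.toℚᵘ-injective (begin
  ℚ.toℚᵘ (ιℚ (a * b))                 ≈⟨ ιℚᵘ (a * b) ⟩
  mkℚᵘ (a * b) 0                       ≈⟨ *≡* refl ⟩
  mkℚᵘ a 0 ℚᵘ.* mkℚᵘ b 0               ≈⟨ ℚᵘP.*-cong (ιℚᵘ a) (ιℚᵘ b) ⟨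
  ℚ.toℚᵘ (ιℚ a) ℚᵘ.* ℚ.toℚᵘ (ιℚ b)    ≈⟨ ℚP.toℚᵘ-homo-* (ιℚ a) (ιℚ b) ⟨
  ℚ.toℚᵘ (ιℚ a ℚ.* ιℚ b)              ∎)
  where open ℚᵘP.≃-Reasoning

ιℚ-neg : ∀ a → ιℚ (- a) ≡ ℚ.- ιℚ a
ιℚ-neg a = ℚP.toℚᵘ-injective (begin
  ℚ.toℚᵘ (ιℚ (- a))                   ≈⟨ ιℚᵘ (- a) ⟩
  ℚᵘ.- mkℚᵘ a 0                        ≈⟨ ℚᵘP.-‿cong (ιℚᵘ a) ⟨
  ℚᵘ.- ℚ.toℚᵘ (ιℚ a)                  ≈⟨ ℚP.toℚᵘ-homo‿- (ιℚ a) ⟨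
  ℚ.toℚᵘ (ℚ.- ιℚ a)                   ∎)
  where open ℚᵘP.≃-Reasoning

ιℚ-- : ∀ a b → ιℚ (a - b) ≡ ιℚ a ℚ.- ιℚ b
ιℚ-- a b = trans (ιℚ-+ a (- b)) (cong (ιℚ a ℚ.+_) (ιℚ-neg b))

ιℚ-[ax-by]-c : ∀ a x b y c → ιℚ (a * x - b * y - c) ≡ ιℚ a ℚ.* ιℚ x ℚ.- ιℚ b ℚ.* ιℚ y ℚ.- ιℚ c
ιℚ-[ax-by]-c a x b y c = begin
  ιℚ (a * x - b * y - c)                        ≡⟨ ιℚ-- (a * x - b * y) c ⟩
  ιℚ (a * x - b * y) ℚ.- ιℚ c                   ≡⟨ cong (ℚ._- ιℚ c) (ιℚ-- (a * x) (b * y)) ⟩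
  ιℚ (a * x) ℚ.- ιℚ (b * y) ℚ.- ιℚ c            ≡⟨ cong₂ (λ s t → s ℚ.- t ℚ.- ιℚ c) (ιℚ-* a x) (ιℚ-* b y) ⟩
  ιℚ a ℚ.* ιℚ x ℚ.- ιℚ b ℚ.* ιℚ y ℚ.- ιℚ c      ∎
  where open ≡-Reasoning

ιℚ-[ax-by]+cw : ∀ a x b y c w →
                ιℚ (a * x - b * y + c * w) ≡ ιℚ a ℚ.* ιℚ x ℚ.- ιℚ b ℚ.* ιℚ y ℚ.+ ιℚ c ℚ.* ιℚ w
ιℚ-[ax-by]+cw a x b y c w = begin
  ιℚ (a * x - b * y + c * w)                          ≡⟨ ιℚ-+ (a * x - b * y) (c * w) ⟩
  ιℚ (a * x - b * y) ℚ.+ ιℚ (c * w)                   ≡⟨ cong₂ ℚ._+_ (ιℚ-- (a * x) (b * y)) (ιℚ-* c w) ⟩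
  ιℚ (a * x) ℚ.- ιℚ (b * y) ℚ.+ ιℚ c ℚ.* ιℚ w
    ≡⟨ cong₂ (λ s t → s ℚ.- t ℚ.+ ιℚ c ℚ.* ιℚ w) (ιℚ-* a x) (ιℚ-* b y) ⟩
  ιℚ a ℚ.* ιℚ x ℚ.- ιℚ b ℚ.* ιℚ y ℚ.+ ιℚ c ℚ.* ιℚ w   ∎
  where open ≡-Reasoning

/-*-ιℚ : ∀ i d .{{_ : ℕ.NonZero d}} → (i ℚ./ d) ℚ.* ιℚ (+ d) ≡ ιℚ i
/-*-ιℚ i (suc d) = ℚP.toℚᵘ-injective (begin
  ℚ.toℚᵘ ((i ℚ./ suc d) ℚ.* ιℚ (+ suc d))           ≈⟨ ℚP.toℚᵘ-homo-* (i ℚ./ suc d) (ιℚ (+ suc d)) ⟩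
  ℚ.toℚᵘ (i ℚ./ suc d) ℚᵘ.* ℚ.toℚᵘ (ιℚ (+ suc d))   ≈⟨ ℚᵘP.*-cong (ℚP.toℚᵘ-fromℚᵘ (mkℚᵘ i d)) (ιℚᵘ (+ suc d)) ⟩
  mkℚᵘ i d ℚᵘ.* mkℚᵘ (+ suc d) 0
    ≈⟨ *≡* (trans (ℤP.*-identityʳ _) (cong (λ e → i * + e) (sym (ℕP.*-identityʳ (suc d))))) ⟩
  mkℚᵘ i 0                                            ≈⟨ ιℚᵘ i ⟨
  ℚ.toℚᵘ (ιℚ i)                                      ∎)
  where open ℚᵘP.≃-Reasoning

ιℚ≢0 : ¬ a ≡ + 0 → ¬ ιℚ a ≡ ℚ.0ℚ
ιℚ≢0 {a} a≢0 ιa≡0 = a≢0 (begin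
  a                                      ≡⟨ ℚP.↥-/ a 1 ⟨
  ℚ.↥ (ιℚ a) * ℤGCD.gcd a (+ 1)          ≡⟨ cong (λ q → ℚ.↥ q * ℤGCD.gcd a (+ 1)) ιa≡0 ⟩
  + 0 * ℤGCD.gcd a (+ 1)                 ≡⟨ ℤP.*-zeroˡ (ℤGCD.gcd a (+ 1)) ⟩
  + 0                                    ∎)
  where open ≡-Reasoning

invℚ-inverseʳ : ∀ q → ¬ q ≡ ℚ.0ℚ → q ℚ.* invℚ q ≡ ℚ.1ℚ
invℚ-inverseʳ q q≢0 with q ℚP.≟ ℚ.0ℚ
... | yes q≡0  = ⊥-elim (q≢0 q≡0)
... | no  q≢0′ = ℚP.*-inverseʳ q {{ℚ.≢-nonZero q≢0′}}

*-cancelʳ-ιℚ : ∀ {x y : ℚ} e .{{_ : ℕ.NonZero e}} → x ℚ.* ιℚ (+ e) ≡ y ℚ.* ιℚ (+ e) → x ≡ y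
*-cancelʳ-ιℚ {x} {y} e eq = begin
  x                                        ≡⟨ ℚP.*-identityʳ x ⟨
  x ℚ.* ℚ.1ℚ                               ≡⟨ cong (x ℚ.*_) ιe*e⁻¹≡1 ⟨
  x ℚ.* (ιℚ (+ e) ℚ.* ((+ 1) ℚ./ e))       ≡⟨ ℚP.*-assoc x _ _ ⟨
  x ℚ.* ιℚ (+ e) ℚ.* ((+ 1) ℚ./ e)         ≡⟨ cong (ℚ._* ((+ 1) ℚ./ e)) eq ⟩
  y ℚ.* ιℚ (+ e) ℚ.* ((+ 1) ℚ./ e)         ≡⟨ ℚP.*-assoc y _ _ ⟩
  y ℚ.* (ιℚ (+ e) ℚ.* ((+ 1) ℚ./ e))       ≡⟨ cong (y ℚ.*_) ιe*e⁻¹≡1 ⟩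
  y ℚ.* ℚ.1ℚ                               ≡⟨ ℚP.*-identityʳ y ⟩
  y                                        ∎
  where
  open ≡-Reasoning
  ιe*e⁻¹≡1 : ιℚ (+ e) ℚ.* ((+ 1) ℚ./ e) ≡ ℚ.1ℚ
  ιe*e⁻¹≡1 = trans (ℚP.*-comm (ιℚ (+ e)) _) (/-*-ιℚ (+ 1) e)

↧ₙ[i/d]∣d : ∀ i d .{{_ : ℕ.NonZero d}} → ℚ.denominatorℕ (i ℚ./ d) ∣ℕ d
↧ₙ[i/d]∣d i d = ℕ∣.divides ℤ.∣ ℤGCD.gcd i (+ d) ∣ (begin
  d                                                          ≡⟨ cong ℤ.∣_∣ (ℚP.↧-/ i d) ⟨
  ℤ.∣ ℚ.↧ (i ℚ./ d) * ℤGCD.gcd i (+ d) ∣                     ≡⟨ ℤP.abs-* (ℚ.↧ (i ℚ./ d)) (ℤGCD.gcd i (+ d)) ⟩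
  ℚ.denominatorℕ (i ℚ./ d) ℕ.* ℤ.∣ ℤGCD.gcd i (+ d) ∣       ≡⟨ ℕP.*-comm (ℚ.denominatorℕ (i ℚ./ d)) _ ⟩
  ℤ.∣ ℤGCD.gcd i (+ d) ∣ ℕ.* ℚ.denominatorℕ (i ℚ./ d)       ∎)
  where open ≡-Reasoning

∣∧∤⇒coprime : ∀ {p d N} → Prime p → d ∣ℕ N → ¬ p ∣ℕ N → Coprime d p
∣∧∤⇒coprime p-prime d∣N p∤N (c∣d , c∣p) with prime⇒irreducible p-prime c∣p
... | inj₁ c≡1 = c≡1
... | inj₂ refl = ⊥-elim (p∤N (ℕ∣.∣-trans c∣d d∣N))

+∣i∣*∣i∣≡i*i : ∀ i → + (ℤ.∣ i ∣ ℕ.* ℤ.∣ i ∣) ≡ i * i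
+∣i∣*∣i∣≡i*i (+ n)    = ℤP.pos-* n n
+∣i∣*∣i∣≡i*i -[1+ n ] = ℤP.pos-* (suc n) (suc n)

-- r = q d / d² has denominator prime to p, and (x − y) d = m q gives x − y = m r.
congModIn-intro : ∀ {p} → Prime p → ∀ {x y : ℚ} {m d z} → ¬ + p ∣ˢ d → m ∣ˢ z →
                  (x ℚ.- y) ℚ.* ιℚ d ≡ ιℚ z → CongModIn p x y m
congModIn-intro {p} p-prime {x} {y} {m} {d} p∤d (divides q refl) [x-y]d≡z =
  (q * d) ℚ./ e , ∣∧∤⇒coprime p-prime (↧ₙ[i/d]∣d (q * d) e) p∤e , *-cancelʳ-ιℚ e (begin
    (x ℚ.- y) ℚ.* ιℚ (+ e)                  ≡⟨ cong ((x ℚ.- y) ℚ.*_) (trans (cong ιℚ (+∣i∣*∣i∣≡i*i d)) (ιℚ-* d d)) ⟩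
    (x ℚ.- y) ℚ.* (ιℚ d ℚ.* ιℚ d)           ≡⟨ ℚP.*-assoc (x ℚ.- y) _ _ ⟨
    (x ℚ.- y) ℚ.* ιℚ d ℚ.* ιℚ d             ≡⟨ cong (ℚ._* ιℚ d) [x-y]d≡z ⟩
    ιℚ (q * m) ℚ.* ιℚ d                     ≡⟨ ιℚ-* (q * m) d ⟨
    ιℚ (q * m * d)                          ≡⟨ cong ιℚ (rearrange q m d) ⟩
    ιℚ (m * (q * d))                        ≡⟨ ιℚ-* m (q * d) ⟩
    ιℚ m ℚ.* ιℚ (q * d)                     ≡⟨ cong (ιℚ m ℚ.*_) (/-*-ιℚ (q * d) e) ⟨
    ιℚ m ℚ.* ((q * d) ℚ./ e ℚ.* ιℚ (+ e))   ≡⟨ ℚP.*-assoc (ιℚ m) _ _ ⟨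
    ιℚ m ℚ.* ((q * d) ℚ./ e) ℚ.* ιℚ (+ e)   ∎)
  where
  open ≡-Reasoning
  e = ℤ.∣ d ∣ ℕ.* ℤ.∣ d ∣
  instance
    ∣d∣≢0 : ℕ.NonZero ℤ.∣ d ∣
    ∣d∣≢0 = ℕ.≢-nonZero λ ∣d∣≡0 → p∤d (subst (+ p ∣ˢ_) (sym (ℤP.∣i∣≡0⇒i≡0 ∣d∣≡0)) (∣0 (+ p)))
    e≢0 : ℕ.NonZero e
    e≢0 = ℕP.m*n≢0 ℤ.∣ d ∣ ℤ.∣ d ∣
  p∤e : ¬ p ∣ℕ e
  p∤e p∣e = ∤*∤⇒∤* p-prime p∤d p∤d (subst (_ ∣ˢ_) (+∣i∣*∣i∣≡i*i d) (ℤ∣.∣ᵤ⇒∣ p∣e))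
  rearrange : ∀ q m d → q * m * d ≡ m * (q * d)
  rearrange = solve-∀

ℚ-ring : ACR.AlmostCommutativeRing 0ℓ 0ℓ
ℚ-ring = ACR.fromCommutativeRing ℚP.+-*-commutativeRing (λ q → dec⇒maybe (ℚ.0ℚ ℚP.≟ q))

residue-ℚ-identity : ∀ {U a b₀ W ε k two : ℚ} → b₀ ≡ ℚ.1ℚ → ε ≡ ℚ.1ℚ →
  (U ℚ.- (a ℚ.* b₀ ℚ.* W ℚ.+ ε ℚ.* k)) ℚ.* two ≡ two ℚ.* U ℚ.- (a ℚ.* two) ℚ.* W ℚ.- k ℚ.* two
residue-ℚ-identity {U} {a} {W = W} {k = k} {two} refl refl = expand U a W k two
  where
  expand : ∀ U a W k two → (U ℚ.- (a ℚ.* ℚ.1ℚ ℚ.* W ℚ.+ ℚ.1ℚ ℚ.* k)) ℚ.* two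
                           ≡ two ℚ.* U ℚ.- (a ℚ.* two) ℚ.* W ℚ.- k ℚ.* two
  expand = ℚSolver.solve-∀ ℚ-ring

nonresidue-ℚ-identity : ∀ {U a b⁻ V ε k two b : ℚ} → b ℚ.* b⁻ ≡ ℚ.1ℚ → ε ≡ ℚ.- ℚ.1ℚ →
  (U ℚ.- (a ℚ.* b⁻ ℚ.* V ℚ.+ ε ℚ.* k)) ℚ.* (two ℚ.* b)
  ≡ two ℚ.* b ℚ.* U ℚ.- (a ℚ.* two) ℚ.* V ℚ.+ b ℚ.* (k ℚ.* two)
nonresidue-ℚ-identity {U} {a} {b⁻} {V} {_} {k} {two} {b} bb⁻≡1 refl = begin
  (U ℚ.- (a ℚ.* b⁻ ℚ.* V ℚ.+ ℚ.- ℚ.1ℚ ℚ.* k)) ℚ.* (two ℚ.* b)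
    ≡⟨ expand U a b⁻ V k two b ⟩
  two ℚ.* b ℚ.* U ℚ.- (a ℚ.* two) ℚ.* V ℚ.* (b ℚ.* b⁻) ℚ.+ b ℚ.* (k ℚ.* two)
    ≡⟨ cong (λ t → two ℚ.* b ℚ.* U ℚ.- (a ℚ.* two) ℚ.* V ℚ.* t ℚ.+ b ℚ.* (k ℚ.* two)) bb⁻≡1 ⟩
  two ℚ.* b ℚ.* U ℚ.- (a ℚ.* two) ℚ.* V ℚ.* ℚ.1ℚ ℚ.+ b ℚ.* (k ℚ.* two)
    ≡⟨ cong (λ t → two ℚ.* b ℚ.* U ℚ.- t ℚ.+ b ℚ.* (k ℚ.* two)) (ℚP.*-identityʳ _) ⟩
  two ℚ.* b ℚ.* U ℚ.- (a ℚ.* two) ℚ.* V ℚ.+ b ℚ.* (k ℚ.* two) ∎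
  where
  open ≡-Reasoning
  expand : ∀ U a b⁻ V k two b → (U ℚ.- (a ℚ.* b⁻ ℚ.* V ℚ.+ ℚ.- ℚ.1ℚ ℚ.* k)) ℚ.* (two ℚ.* b)
                               ≡ two ℚ.* b ℚ.* U ℚ.- (a ℚ.* two) ℚ.* V ℚ.* (b ℚ.* b⁻) ℚ.+ b ℚ.* (k ℚ.* two)
  expand = ℚSolver.solve-∀ ℚ-ring

odd⇒≡1+2k : ∀ {p} → p ℕ.% 2 ≡ 1 → ∃ λ k → p ≡ suc (k ℕ.+ k)
odd⇒≡1+2k {p} p%2≡1 = p ℕ./ 2 , trans (m≡m%n+[m/n]*n p 2) (cong₂ ℕ._+_ p%2≡1 (double (p ℕ./ 2)))
  where
  double : ∀ h → h ℕ.* 2 ≡ h ℕ.+ h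
  double h = trans (ℕP.*-comm h 2) (cong (h ℕ.+_) (ℕP.+-identityʳ h))

lucasRHS : ℤ → ℤ → ℕ → ℤ → ℚ
lucasRHS A B p ε = (A ℚ./ 2) ℚ.* (ιℚ B ^ℚℤ ((ε ℤ.- + 1) ℤ./ℕ 2)) ℚ.* ιℚ (lucasU A B ℤ.∣ + p ℤ.- ε ∣)
                   ℚ.+ ιℚ ε ℚ.* (((B ℤ.^ (p ℕ.∸ 1)) ℤ.+ + 1) ℚ./ 2)

module _ (A B : ℤ) {k} (p-prime : Prime (suc (k ℕ.+ k))) (p∤BΔ : ¬ + suc (k ℕ.+ k) ∣ˢ B * (A * A - + 4 * B)) where
  private
    p : ℕ
    p = suc (k ℕ.+ k)
    Δ = A * A - + 4 * B
    u = lucasU A B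
    K = B ^ (k ℕ.+ k) + + 1
    p∤B : ¬ + p ∣ˢ B
    p∤B p∣B = p∤BΔ (ℤ∣.∣m⇒∣m*n Δ p∣B)
    p∤Δ : ¬ + p ∣ˢ Δ
    p∤Δ p∣Δ = p∤BΔ (ℤ∣.∣n⇒∣m*n B p∣Δ)
    p∤2 : ¬ + p ∣ˢ + 2
    p∤2 = 0<n<p⇒∤ (s≤s z≤n) (odd-prime>2 {k} p-prime)
    p∤2B : ¬ + p ∣ˢ + 2 * B
    p∤2B = ∤*∤⇒∤* p-prime p∤2 p∤B
    open Euler {k} p-prime p∤Δ
    open LucasModPrime A B {k} p-prime

  residue-congruence : (∃ λ x → + p ∣ˢ + x * + x - Δ) → CongModIn p (ιℚ (u p)) (lucasRHS A B p (+ 1)) (+ (p ℕ.* p))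
  residue-congruence (x , p∣x²-Δ) =
    congModIn-intro p-prime {ιℚ (u p)} {lucasRHS A B p (+ 1)} p∤2
      (residue⇒p²∣ A B p-prime p∤2B (≡mod-trans (proj₁ lucas-mod-p) (euler-residue (+ x) p∣x²-Δ)) (proj₂ lucas-mod-p))
      (begin
        (ιℚ (u p) ℚ.- lucasRHS A B p (+ 1)) ℚ.* ιℚ (+ 2)
          ≡⟨ residue-ℚ-identity {ιℚ (u p)} {A ℚ./ 2} {ιℚ B ^ℚℤ ((+ 1 ℤ.- + 1) ℤ./ℕ 2)} {ιℚ (u (k ℕ.+ k))}
                                {ιℚ (+ 1)} {K ℚ./ 2} {ιℚ (+ 2)} refl refl ⟩
        ιℚ (+ 2) ℚ.* ιℚ (u p) ℚ.- (A ℚ./ 2 ℚ.* ιℚ (+ 2)) ℚ.* ιℚ (u (k ℕ.+ k)) ℚ.- K ℚ./ 2 ℚ.* ιℚ (+ 2)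
          ≡⟨ cong₂ (λ s t → ιℚ (+ 2) ℚ.* ιℚ (u p) ℚ.- s ℚ.* ιℚ (u (k ℕ.+ k)) ℚ.- t) (/-*-ιℚ A 2) (/-*-ιℚ K 2) ⟩
        ιℚ (+ 2) ℚ.* ιℚ (u p) ℚ.- ιℚ A ℚ.* ιℚ (u (k ℕ.+ k)) ℚ.- ιℚ K
          ≡⟨ ιℚ-[ax-by]-c (+ 2) (u p) A (u (k ℕ.+ k)) K ⟨
        ιℚ (+ 2 * u p - A * u (k ℕ.+ k) - K) ∎)
    where open ≡-Reasoning

  nonresidue-congruence : (∀ x → x < p → ¬ + p ∣ˢ + x * + x - Δ) →
                          CongModIn p (ιℚ (u p)) (lucasRHS A B p -[1+ 0 ]) (+ (p ℕ.* p))
  nonresidue-congruence nonresidue =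
    congModIn-intro p-prime {ιℚ (u p)} {lucasRHS A B p -[1+ 0 ]} p∤2B
      (nonresidue⇒p²∣ A B p-prime p∤2B (≡mod-trans (proj₁ lucas-mod-p) (euler-nonresidue nonresidue)) (proj₂ lucas-mod-p))
      (begin
        (ιℚ (u p) ℚ.- lucasRHS A B p -[1+ 0 ]) ℚ.* ιℚ (+ 2 * B)
          ≡⟨ cong ((ιℚ (u p) ℚ.- lucasRHS A B p -[1+ 0 ]) ℚ.*_) (ιℚ-* (+ 2) B) ⟩
        (ιℚ (u p) ℚ.- lucasRHS A B p -[1+ 0 ]) ℚ.* (ιℚ (+ 2) ℚ.* ιℚ B)
          ≡⟨ nonresidue-ℚ-identity {ιℚ (u p)} {A ℚ./ 2} {B⁻¹} {ιℚ (u ℤ.∣ + p ℤ.- -[1+ 0 ] ∣)} {ιℚ -[1+ 0 ]}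
                                   {K ℚ./ 2} {ιℚ (+ 2)} {ιℚ B} B*B⁻¹≡1 refl ⟩
        ιℚ (+ 2) ℚ.* ιℚ B ℚ.* ιℚ (u p) ℚ.- (A ℚ./ 2 ℚ.* ιℚ (+ 2)) ℚ.* ιℚ (u ℤ.∣ + p ℤ.- -[1+ 0 ] ∣)
          ℚ.+ ιℚ B ℚ.* (K ℚ./ 2 ℚ.* ιℚ (+ 2))
          ≡⟨ cong₂ (λ s t → ιℚ (+ 2) ℚ.* ιℚ B ℚ.* ιℚ (u p) ℚ.- s ℚ.* ιℚ (u ℤ.∣ + p ℤ.- -[1+ 0 ] ∣) ℚ.+ ιℚ B ℚ.* t)
                   (/-*-ιℚ A 2) (/-*-ιℚ K 2) ⟩
        ιℚ (+ 2) ℚ.* ιℚ B ℚ.* ιℚ (u p) ℚ.- ιℚ A ℚ.* ιℚ (u ℤ.∣ + p ℤ.- -[1+ 0 ] ∣) ℚ.+ ιℚ B ℚ.* ιℚ K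
          ≡⟨ cong (λ i → ιℚ (+ 2) ℚ.* ιℚ B ℚ.* ιℚ (u p) ℚ.- ιℚ A ℚ.* ιℚ (u i) ℚ.+ ιℚ B ℚ.* ιℚ K) (ℕP.+-comm p 1) ⟩
        ιℚ (+ 2) ℚ.* ιℚ B ℚ.* ιℚ (u p) ℚ.- ιℚ A ℚ.* ιℚ (u (suc p)) ℚ.+ ιℚ B ℚ.* ιℚ K
          ≡⟨ cong (λ t → t ℚ.* ιℚ (u p) ℚ.- ιℚ A ℚ.* ιℚ (u (suc p)) ℚ.+ ιℚ B ℚ.* ιℚ K) (ιℚ-* (+ 2) B) ⟨
        ιℚ (+ 2 * B) ℚ.* ιℚ (u p) ℚ.- ιℚ A ℚ.* ιℚ (u (suc p)) ℚ.+ ιℚ B ℚ.* ιℚ K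
          ≡⟨ ιℚ-[ax-by]+cw (+ 2 * B) (u p) A (u (suc p)) B K ⟨
        ιℚ (+ 2 * B * u p - A * u (suc p) + B * K) ∎)
    where
    open ≡-Reasoning
    B⁻¹ = ιℚ B ^ℚℤ ((-[1+ 0 ] ℤ.- + 1) ℤ./ℕ 2)
    B≢0 : ¬ B ≡ + 0
    B≢0 refl = p∤B (∣0 (+ p))
    B*B⁻¹≡1 : ιℚ B ℚ.* B⁻¹ ≡ ℚ.1ℚ
    B*B⁻¹≡1 = trans (cong (ℚ._* B⁻¹) (sym (ℚP.*-identityʳ (ιℚ B))))
                    (invℚ-inverseʳ (ιℚ B ℚ.* ℚ.1ℚ)
                                   (λ B*1≡0 → ιℚ≢0 B≢0 (trans (sym (ℚP.*-identityʳ (ιℚ B))) B*1≡0)))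

  lucas-congruence : ∀ {ε} →
      (ε ≡ + 1 × ∃ λ x → + p ∣ˢ + x * + x - Δ) ⊎ (ε ≡ -1ℤ × ∀ x → x < p → ¬ + p ∣ˢ + x * + x - Δ) →
      CongModIn p (ιℚ (u p)) (lucasRHS A B p ε) (+ (p ℕ.* p))
  lucas-congruence (inj₁ (refl , residue)) = residue-congruence residue
  -- Matching on refl here instead makes type checking exceedingly slow.
  lucas-congruence {ε} (inj₂ (ε≡-1 , nonresidue)) =
    subst (λ ε → CongModIn p (ιℚ (u p)) (lucasRHS A B p ε) (+ (p ℕ.* p))) (sym ε≡-1) (nonresidue-congruence nonresidue)

lemma3p2 : (A B : ℤ) (p : ℕ) → Prime p → p ℕ.% 2 ≡ 1 →
    ¬ ((+ p) ∣ (B ℤ.* (A ℤ.* A ℤ.- + 4 ℤ.* B))) →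
    CongModIn p
      (ιℚ (lucasU A B p))
      ((A ℚ./ 2) ℚ.* (ιℚ B ^ℚℤ ((legendre (A ℤ.* A ℤ.- + 4 ℤ.* B) p ℤ.- + 1) ℤ./ℕ 2))
         ℚ.* ιℚ (lucasU A B ℤ.∣ + p ℤ.- legendre (A ℤ.* A ℤ.- + 4 ℤ.* B) p ∣)
       ℚ.+ ιℚ (legendre (A ℤ.* A ℤ.- + 4 ℤ.* B) p)
         ℚ.* (((B ℤ.^ (p ℕ.∸ 1)) ℤ.+ + 1) ℚ./ 2))
      (+ (p ℕ.* p))
lemma3p2 A B p p-prime odd p∤BΔ with odd⇒≡1+2k {p} odd
... | k , refl =
  lucas-congruence A B {k} p-prime p∤BΔ′ (legendre-dichotomy (A * A - + 4 * B) p-prime (p∤BΔ′ ∘ ℤ∣.∣n⇒∣m*n B))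
  where
  p∤BΔ′ : ¬ + p ∣ˢ B * (A * A - + 4 * B)
  p∤BΔ′ = p∤BΔ ∘ ℤ∣.∣⇒∣ᵤ
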